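{- For every positive integer $N$ there exist a finite, simple, connected graph $G$ and a graphoidal cover $\psi$ of $G$ such that $|D(G)-D(\Omega(G,\psi))| \ge N$ and $|D'(G)-D'(\Omega(G,\psi))| \ge N$.
   Context: A graphoidal cover of a graph $G$ is a collection $\psi$ of (not necessarily open) paths in $G$ — cycles are allowed as closed paths, with a designated starting vertex as their terminal vertex and all other vertices internal — such that: every path in $\psi$ has at least two vertices; every vertex of $G$ is an internal vertex of at most one path in $\psi$; every edge of $G$ lies in exactly one path in $\psi$. $\Omega(G,\psi)$ is the intersection graph of $\psi$: its vertices are the paths in $\psi$, two being adjacent iff they share a vertex. $D(H)$ (distinguishing number) is the least $r$ such that $H$ has a vertex labeling with $r$ labels preserved only by the identity automorphism; $D'(H)$ (distinguishing index) is the least $d$ such that $H$ has an edge labeling with $d$ labels preserved only by the identity automorphism. -}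

module Defs where

open import Data.Nat using (ℕ; zero; suc; _≤_; _<_)
open import Data.Fin using (Fin; zero; suc; inject₁; fromℕ; _≟_)
open import Data.Fin.Properties using (any?)
open import Data.Fin.Permutation using (Permutation′; _⟨$⟩ʳ_)
open import Data.Bool using (Bool; true; false; _∧_)
open import Data.Product using (Σ; ∃; ∃-syntax; _×_; _,_; proj₁; proj₂)
open import Data.Sum using (_⊎_; inj₁; inj₂)
open import Relation.Nullary using (¬_; Dec; yes; no)
open import Data.Empty using (⊥-elim)
open import Relation.Nullary.Decidable using (⌊_⌋; ¬?; _×-dec_)
open import Relation.Binary.PropositionalEquality using (_≡_; _≢_; refl; sym; cong)
open import Function.Definitions using (Injective)

record Graph : Set where
  field
    n     : ℕ
    adj   : Fin n → Fin n → Bool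
    adjSym : ∀ u v → adj u v ≡ adj v u
    adjIrr : ∀ v → adj v v ≡ false

open Graph public

data Reach (G : Graph) : Fin (n G) → Fin (n G) → Set where
  here : ∀ {u} → Reach G u u
  step : ∀ {u w v} → adj G u w ≡ true → Reach G w v → Reach G u v

Connected : Graph → Set
Connected G = ∀ u v → Reach G u v

IsAut : (G : Graph) → Permutation′ (n G) → Set
IsAut G σ = ∀ u v → adj G (σ ⟨$⟩ʳ u) (σ ⟨$⟩ʳ v) ≡ adj G u v

IsIdentity : ∀ {m} → Permutation′ m → Set
IsIdentity σ = ∀ v → σ ⟨$⟩ʳ v ≡ v

DistinguishingVL : (G : Graph) (r : ℕ) → (Fin (n G) → Fin r) → Set
DistinguishingVL G r c =
  ∀ σ → IsAut G σ → (∀ v → c (σ ⟨$⟩ʳ v) ≡ c v) → IsIdentity σ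

-- edge labeling with d labels: a symmetric function on vertex pairs whose
-- values on edges are the labels (values on non-edges are irrelevant).
record EdgeLabeling (G : Graph) (d : ℕ) : Set where
  field
    lab    : Fin (n G) → Fin (n G) → Fin d
    labSym : ∀ u v → lab u v ≡ lab v u

DistinguishingEL : (G : Graph) (d : ℕ) → EdgeLabeling G d → Set
DistinguishingEL G d L =
  ∀ σ → IsAut G σ →
    (∀ u v → adj G u v ≡ true →
       EdgeLabeling.lab L (σ ⟨$⟩ʳ u) (σ ⟨$⟩ʳ v) ≡ EdgeLabeling.lab L u v) →
    IsIdentity σ

IsDistNumber : Graph → ℕ → Set
IsDistNumber G r =
  (∃[ c ] DistinguishingVL G r c) ×
  (∀ s → s < r → ¬ (∃[ c ] DistinguishingVL G s c))

IsDistIndex : Graph → ℕ → Set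
IsDistIndex G d =
  (∃[ L ] DistinguishingEL G d L) ×
  (∀ s → s < d → ¬ (∃[ L ] DistinguishingEL G s L))

-- (Not necessarily open) paths in G.

record GPath (G : Graph) : Set where
  field
    len      : ℕ
    len≥1    : 1 ≤ len
    vtx      : Fin (suc len) → Fin (n G)
    adjacent : ∀ (i : Fin len) → adj G (vtx (inject₁ i)) (vtx (suc i)) ≡ true
    shape    : Injective _≡_ _≡_ vtx
             ⊎ (vtx zero ≡ vtx (fromℕ len) × 3 ≤ len ×
                (∀ (i j : Fin len) → vtx (inject₁ i) ≡ vtx (inject₁ j) → i ≡ j))

open GPath public

OnPath : ∀ {G} → GPath G → Fin (n G) → Set
OnPath P v = ∃[ i ] vtx P i ≡ v

-- internal vertex: on P but not a terminal vertex (for a cycle the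
-- terminal vertex is the designated start vtx 0 ≡ vtx len)
Internal : ∀ {G} → GPath G → Fin (n G) → Set
Internal P v = OnPath P v × v ≢ vtx P zero × v ≢ vtx P (fromℕ (len P))

EdgeOn : ∀ {G} → GPath G → Fin (n G) → Fin (n G) → Set
EdgeOn P u v = ∃[ i ] ((vtx P (inject₁ i) ≡ u × vtx P (suc i) ≡ v)
                     ⊎ (vtx P (inject₁ i) ≡ v × vtx P (suc i) ≡ u))

record GraphoidalCover (G : Graph) : Set where
  field
    m        : ℕ
    path     : Fin m → GPath G
    intUniq  : ∀ v i j → Internal (path i) v → Internal (path j) v → i ≡ j
    edgeUniq : ∀ u v → adj G u v ≡ true →
               ∃[ i ] (EdgeOn (path i) u v × (∀ j → EdgeOn (path j) u v → j ≡ i))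

open GraphoidalCover public

Shares : ∀ {G} → GPath G → GPath G → Set
Shares P Q = ∃[ a ] ∃[ b ] vtx P a ≡ vtx Q b

shares? : ∀ {G} (P Q : GPath G) → Dec (Shares P Q)
shares? P Q = any? (λ a → any? (λ b → vtx P a ≟ vtx Q b))

ΩAdj : ∀ {G} (ψ : GraphoidalCover G) → Fin (m ψ) → Fin (m ψ) → Bool
ΩAdj ψ i j = ⌊ ¬? (i ≟ j) ×-dec shares? (path ψ i) (path ψ j) ⌋

private
  ≢-sym : ∀ {a} {A : Set a} {x y : A} → x ≢ y → y ≢ x
  ≢-sym p q = p (sym q)

  shares-sym : ∀ {G} {P Q : GPath G} → Shares P Q → Shares Q P
  shares-sym (a , b , e) = b , a , sym e

  ΩAdj-sym : ∀ {G} (ψ : GraphoidalCover G) i j → ΩAdj ψ i j ≡ ΩAdj ψ j i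
  ΩAdj-sym ψ i j with i ≟ j | j ≟ i
  ... | yes p | yes q = refl
  ... | yes p | no q = ⊥-elim (q (sym p))
  ... | no p | yes q = ⊥-elim (p (sym q))
  ... | no p | no q with shares? (path ψ i) (path ψ j) | shares? (path ψ j) (path ψ i)
  ...   | yes s | yes t = refl
  ...   | yes s | no t = ⊥-elim (t (shares-sym {P = path ψ i} {Q = path ψ j} s))
  ...   | no s | yes t = ⊥-elim (s (shares-sym {P = path ψ j} {Q = path ψ i} t))
  ...   | no s | no t = refl

  ΩAdj-irr : ∀ {G} (ψ : GraphoidalCover G) i → ΩAdj ψ i i ≡ false
  ΩAdj-irr ψ i with i ≟ i
  ... | yes _ = refl
  ... | no p = ⊥-elim (p refl)

Ω : (G : Graph) → GraphoidalCover G → Graph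
Ω G ψ = record { n = m ψ ; adj = ΩAdj ψ ; adjSym = ΩAdj-sym ψ ; adjIrr = ΩAdj-irr ψ }

module Submission where

-- Take G to be the caterpillar whose spine s₀ … s_k carries one
-- pendant leaf ℓ_{i+1} at each s_i plus a second leaf ℓ₀ at s₀, and let
-- ψ consist of the path P₀ = ℓ₀ s₀ s₁ … s_k and the k+1 pendant edges
-- s_i ℓ_{i+1}.  The paths s_i ℓ_{i+1} are pairwise disjoint and all meet
-- P₀, so Ω(G,ψ) is the star K_{1,k+1}, whereas G has D(G) = D'(G) = 2.
--
-- Both kinds of bound come from two general facts.  Lower bounds: if a
-- graph has M pairwise twin pendant vertices at a common hub, then two
-- of them get the same label under fewer than M labels, and swapping
-- them is a non-trivial automorphism preserving the labelling; hence
-- D, D' ≥ M.  Upper bounds: an explicit labelling is shown to be fixed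
-- only by the identity -- for the star because every automorphism fixes
-- the centre, for the caterpillar because an automorphism fixing ℓ₀ is
-- forced, step by step along the spine, to be the identity.  With
-- k = N + 1 the theorem follows from |2 - (N + 2)| = N.

open import Defs
open import Data.Nat using (ℕ; zero; suc; _+_; _<_; _≤_; _≡ᵇ_; z≤n; s≤s; ∣_-_∣)
import Data.Nat.Properties as ℕ
open import Data.Fin using (Fin; zero; suc; toℕ; inject₁; splitAt; join; _≟_)
  renaming (_<_ to _<ᶠ_)
open import Data.Fin.Properties
  using (pigeonhole; <⇒≢; <-irrefl; toℕ-injective; toℕ-inject₁; splitAt-join; join-splitAt)
import Data.Fin.Permutation.Components as PC
open import Data.Fin.Permutation
  using (Permutation′; _⟨$⟩ʳ_; _⟨$⟩ˡ_; transpose; inverseˡ; inverseʳ)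
open import Data.Bool using (Bool; true; false; _∨_)
open import Data.Bool.Properties using (∨-comm; T-≡)
open import Data.Sum using (_⊎_; inj₁; inj₂)
open import Data.Sum.Properties using (inj₁-injective)
open import Data.Product using (∃-syntax; _×_; _,_; proj₁; proj₂)
open import Data.Empty using (⊥-elim)
open import Data.Fin.Induction using (<-wellFounded; <-weakInduction)
open import Induction.WellFounded using (module All)
open import Function using (_∘_; Equivalence)
open import Relation.Nullary using (¬_; Dec; yes; no)
open import Relation.Nullary.Decidable using (isYes; dec-true; dec-false; isYes≗does; ¬?; _×-dec_)
open import Relation.Binary.PropositionalEquality
  using (_≡_; _≢_; refl; sym; trans; cong; cong₂; subst; subst₂)

perm-injective : ∀ {n} (σ : Permutation′ n) {a b} → σ ⟨$⟩ʳ a ≡ σ ⟨$⟩ʳ b → a ≡ b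
perm-injective σ {a} {b} e =
  trans (sym (inverseˡ σ)) (trans (cong (σ ⟨$⟩ˡ_) e) (inverseˡ σ))

transpose-cases : ∀ {n} (a b x : Fin n) →
  (x ≡ a × PC.transpose a b x ≡ b) ⊎ (x ≡ b × PC.transpose a b x ≡ a) ⊎
  (x ≢ a × x ≢ b × PC.transpose a b x ≡ x)
transpose-cases a b x with x ≟ a
... | yes x≡a = inj₁ (x≡a , refl)
... | no x≢a with x ≟ b
...   | yes x≡b = inj₂ (inj₁ (x≡b , refl))
...   | no x≢b = inj₂ (inj₂ (x≢a , x≢b , refl))

transpose-respects : ∀ {n} {A : Set} (g : Fin n → A) {a b} → g a ≡ g b →
                     ∀ x → g (PC.transpose a b x) ≡ g x
transpose-respects g {a} {b} ga≡gb x with transpose-cases a b x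
... | inj₁ (refl , τx≡b) = trans (cong g τx≡b) (sym ga≡gb)
... | inj₂ (inj₁ (refl , τx≡a)) = trans (cong g τx≡a) ga≡gb
... | inj₂ (inj₂ (_ , _ , τx≡x)) = cong g τx≡x

transpose-not-identity : ∀ {n} {a b : Fin n} → a ≢ b → ¬ IsIdentity (transpose a b)
transpose-not-identity {a = a} {b} a≢b is-id with transpose-cases a b a
... | inj₁ (_ , τa≡b) = a≢b (trans (sym (is-id a)) τa≡b)
... | inj₂ (inj₁ (a≡b , _)) = a≢b a≡b
... | inj₂ (inj₂ (a≢a , _)) = a≢a refl

Twins : (G : Graph) → Fin (n G) → Fin (n G) → Set
Twins G a b = ∀ x → adj G a x ≡ adj G b x

module _ (G : Graph) {a b : Fin (n G)} (twins : Twins G a b) where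

  private
    τ : Fin (n G) → Fin (n G)
    τ = PC.transpose a b

  swap-isAut : IsAut G (transpose a b)
  swap-isAut u v =
    trans (transpose-respects (adj G (τ u)) twinsʳ v)
          (transpose-respects (λ y → adj G y v) (twins v) u)
    where
    twinsʳ : adj G (τ u) a ≡ adj G (τ u) b
    twinsʳ = trans (adjSym G (τ u) a) (trans (twins (τ u)) (adjSym G b (τ u)))

  -- A neighbour of a twin is moved by neither a nor b, so it is fixed.
  swap-fixes-neighbour : ∀ {x} → adj G a x ≡ true → τ x ≡ x
  swap-fixes-neighbour {x} ax with transpose-cases a b x
  ... | inj₁ (refl , _) with trans (sym ax) (adjIrr G a)
  ...   | ()
  swap-fixes-neighbour ax | inj₂ (inj₁ (refl , _)) with trans (sym ax) (trans (twins b) (adjIrr G b))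
  ...   | ()
  swap-fixes-neighbour ax | inj₂ (inj₂ (_ , _ , τx≡x)) = τx≡x

  swap-preserves-edge-labels :
    ∀ {d} (L : EdgeLabeling G d) → let open EdgeLabeling L in
    (∀ x → adj G a x ≡ true → lab a x ≡ lab b x) →
    ∀ u v → adj G u v ≡ true → lab (τ u) (τ v) ≡ lab u v
  swap-preserves-edge-labels L agree = preserves
    where
    open EdgeLabeling L

    from-twin : ∀ u v → adj G u v ≡ true → u ≡ a ⊎ u ≡ b → lab (τ u) (τ v) ≡ lab u v
    from-twin u v uv u∈ab with transpose-cases a b u
    ... | inj₁ (refl , τu≡b) =
      trans (cong₂ lab τu≡b (swap-fixes-neighbour uv)) (sym (agree v uv))
    ... | inj₂ (inj₁ (refl , τu≡a)) =
      trans (cong₂ lab τu≡a (swap-fixes-neighbour (trans (twins v) uv)))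
            (agree v (trans (twins v) uv))
    ... | inj₂ (inj₂ (u≢a , u≢b , _)) with u∈ab
    ...   | inj₁ u≡a = ⊥-elim (u≢a u≡a)
    ...   | inj₂ u≡b = ⊥-elim (u≢b u≡b)

    to-twin : ∀ u v → adj G u v ≡ true → v ≡ a ⊎ v ≡ b → lab (τ u) (τ v) ≡ lab u v
    to-twin u v uv v∈ab = trans (labSym _ _)
      (trans (from-twin v u (trans (adjSym G v u) uv) v∈ab) (labSym v u))

    preserves : ∀ u v → adj G u v ≡ true → lab (τ u) (τ v) ≡ lab u v
    preserves u v uv with transpose-cases a b u | transpose-cases a b v
    ... | inj₁ (u≡a , _) | _ = from-twin u v uv (inj₁ u≡a)
    ... | inj₂ (inj₁ (u≡b , _)) | _ = from-twin u v uv (inj₂ u≡b)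
    ... | inj₂ (inj₂ _) | inj₁ (v≡a , _) = to-twin u v uv (inj₁ v≡a)
    ... | inj₂ (inj₂ _) | inj₂ (inj₁ (v≡b , _)) = to-twin u v uv (inj₂ v≡b)
    ... | inj₂ (inj₂ (_ , _ , τu≡u)) | inj₂ (inj₂ (_ , _ , τv≡v)) = cong₂ lab τu≡u τv≡v

record PendantTwins (G : Graph) (M : ℕ) : Set where
  field
    hub       : Fin (n G)
    leaf      : Fin M → Fin (n G)
    distinct  : ∀ {i j} → leaf i ≡ leaf j → i ≡ j
    twins     : ∀ i j → Twins G (leaf i) (leaf j)
    pendant   : ∀ i x → adj G (leaf i) x ≡ true → x ≡ hub

module _ {G : Graph} {M : ℕ} (P : PendantTwins G M) where
  open PendantTwins P

  private
    twin-collision : ∀ {s} → s < M → (f : Fin M → Fin s) →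
                     ∃[ i ] ∃[ j ] (leaf i ≢ leaf j × f i ≡ f j)
    twin-collision s<M f with pigeonhole s<M f
    ... | i , j , i<j , same = i , j , (<⇒≢ i<j ∘ distinct) , same

  pendantTwins⇒distNumber≥ : ∀ s → s < M → ¬ (∃[ c ] DistinguishingVL G s c)
  pendantTwins⇒distNumber≥ s s<M (c , dist) with twin-collision s<M (c ∘ leaf)
  ... | i , j , leaves-differ , same =
    transpose-not-identity leaves-differ
      (dist (transpose (leaf i) (leaf j)) (swap-isAut G (twins i j))
        (transpose-respects c same))

  -- D'(G) ≥ M: here the labels of the pendant edges hub–leaf collide.
  pendantTwins⇒distIndex≥ : ∀ s → s < M → ¬ (∃[ L ] DistinguishingEL G s L)
  pendantTwins⇒distIndex≥ s s<M (L , dist)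
    with twin-collision s<M (λ i → EdgeLabeling.lab L (leaf i) hub)
  ... | i , j , leaves-differ , same =
    transpose-not-identity leaves-differ
      (dist (transpose (leaf i) (leaf j)) (swap-isAut G (twins i j))
        (swap-preserves-edge-labels G (twins i j) L agree))
    where
    agree : ∀ x → adj G (leaf i) x ≡ true →
            EdgeLabeling.lab L (leaf i) x ≡ EdgeLabeling.lab L (leaf j) x
    agree x e with pendant i x e
    ... | refl = same

starAdj : ∀ {M} → Fin (suc M) → Fin (suc M) → Bool
starAdj zero    zero    = false
starAdj zero    (suc _) = true
starAdj (suc _) zero    = true
starAdj (suc _) (suc _) = false

module Star (k : ℕ) (A : Fin (3 + k) → Fin (3 + k) → Bool)
            (A-sym : ∀ u v → A u v ≡ A v u) (A-irr : ∀ v → A v v ≡ false)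
            (A-star : ∀ u v → A u v ≡ starAdj u v) where

  M : ℕ
  M = 2 + k

  H : Graph
  H = record { n = suc M ; adj = A ; adjSym = A-sym ; adjIrr = A-irr }

  leaves : PendantTwins H M
  leaves = record
    { hub = zero ; leaf = suc ; distinct = λ { refl → refl }
    ; twins = λ i j x → trans (A-star (suc i) x) (trans (same i j x) (sym (A-star (suc j) x)))
    ; pendant = pendant }
    where
    same : ∀ i j x → starAdj {M} (suc i) x ≡ starAdj (suc j) x
    same i j zero    = refl
    same i j (suc x) = refl

    pendant : ∀ i x → A (suc i) x ≡ true → x ≡ zero
    pendant i zero    _ = refl
    pendant i (suc x) e with trans (sym e) (A-star (suc i) (suc x))
    ... | ()

  -- Every automorphism fixes the centre: were it mapped to a leaf, the
  -- two distinct leaves suc 0 and suc 1 (here M ≥ 2 is used) would both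
  -- be mapped to the unique neighbour of that leaf.
  centre-fixed : ∀ σ → IsAut H σ → σ ⟨$⟩ʳ zero ≡ zero
  centre-fixed σ aut with σ ⟨$⟩ʳ zero in σ0≡
  ... | zero  = refl
  ... | suc j with perm-injective σ (trans (to-centre zero) (sym (to-centre (suc zero))))
    where
    to-centre : ∀ i → σ ⟨$⟩ʳ suc i ≡ zero
    to-centre i = PendantTwins.pendant leaves j (σ ⟨$⟩ʳ suc i)
      (trans (cong (λ c → A c (σ ⟨$⟩ʳ suc i)) (sym σ0≡))
             (trans (aut zero (suc i)) (A-star zero (suc i))))
  ...   | ()

  leafwise-identity : ∀ σ → IsAut H σ →
                      (∀ i j → σ ⟨$⟩ʳ suc i ≡ suc j → j ≡ i) → IsIdentity σ
  leafwise-identity σ aut same zero = centre-fixed σ aut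
  leafwise-identity σ aut same (suc i) with σ ⟨$⟩ʳ suc i in σi≡
  ... | zero with perm-injective σ (trans σi≡ (sym (centre-fixed σ aut)))
  ...   | ()
  leafwise-identity σ aut same (suc i) | suc j = cong suc (same i j σi≡)

  vertexLabel : Fin (suc M) → Fin M
  vertexLabel zero    = zero
  vertexLabel (suc i) = i

  distNumber : IsDistNumber H M
  distNumber = (vertexLabel , distinguishing) , pendantTwins⇒distNumber≥ leaves
    where
    distinguishing : DistinguishingVL H M vertexLabel
    distinguishing σ aut pres = leafwise-identity σ aut
      (λ i j σi≡ → trans (cong vertexLabel (sym σi≡)) (pres (suc i)))

  edgeLabel : Fin (suc M) → Fin (suc M) → Fin M
  edgeLabel zero    (suc i) = i
  edgeLabel (suc i) zero    = i
  edgeLabel _       _       = zero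

  edgeLabel-sym : ∀ u v → edgeLabel u v ≡ edgeLabel v u
  edgeLabel-sym zero    zero    = refl
  edgeLabel-sym zero    (suc v) = refl
  edgeLabel-sym (suc u) zero    = refl
  edgeLabel-sym (suc u) (suc v) = refl

  distIndex : IsDistIndex H M
  distIndex = (L , distinguishing) , pendantTwins⇒distIndex≥ leaves
    where
    L : EdgeLabeling H M
    L = record { lab = edgeLabel ; labSym = edgeLabel-sym }

    distinguishing : DistinguishingEL H M L
    distinguishing σ aut pres = leafwise-identity σ aut
      (λ i j σi≡ → trans (cong₂ edgeLabel (sym (centre-fixed σ aut)) (sym σi≡))
                         (pres zero (suc i) (A-star zero (suc i))))

reach-append : ∀ {G a b c} → Reach G a b → Reach G b c → Reach G a c
reach-append here        r′ = r′
reach-append (step e r)  r′ = step e (reach-append r r′)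

reach-sym : ∀ {G a b} → Reach G a b → Reach G b a
reach-sym here = here
reach-sym {G} (step {u} {w} e r) = reach-append (reach-sym r) (step (trans (adjSym G w u) e) here)

connected-via-root : ∀ G (root : Fin (n G)) → (∀ v → Reach G v root) → Connected G
connected-via-root G root reaches u v = reach-append (reaches u) (reach-sym (reaches v))

≡ᵇ-sound : ∀ {a b} → (a ≡ᵇ b) ≡ true → a ≡ b
≡ᵇ-sound {a} {b} e = ℕ.≡ᵇ⇒≡ a b (Equivalence.from T-≡ e)

≡ᵇ-refl : ∀ a → (a ≡ᵇ a) ≡ true
≡ᵇ-refl a = Equivalence.to T-≡ (ℕ.≡⇒≡ᵇ a a refl)

≡ᵇ-suc : ∀ a → (a ≡ᵇ suc a) ≡ false
≡ᵇ-suc zero    = refl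
≡ᵇ-suc (suc a) = ≡ᵇ-suc a

∨-true-split : ∀ {p q} → p ∨ q ≡ true → p ≡ true ⊎ q ≡ true
∨-true-split {true}  _ = inj₁ refl
∨-true-split {false} e = inj₂ e

isYes-true : ∀ {A : Set} (d : Dec A) → A → isYes d ≡ true
isYes-true d a = trans (isYes≗does d) (dec-true d a)

isYes-false : ∀ {A : Set} (d : Dec A) → ¬ A → isYes d ≡ false
isYes-false d ¬a = trans (isYes≗does d) (dec-false d ¬a)

-- The caterpillar: spine vertices s_i (i ≤ k) forming a path, and leaves
-- ℓ_l (l ≤ k + 1), the leaf ℓ_l hanging at s_(attach l); thus s₀ carries
-- the two leaves ℓ₀, ℓ₁ and s_i carries ℓ_{i+1}.
module Caterpillar (k : ℕ) where

  Vertex : Set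
  Vertex = Fin (suc k) ⊎ Fin (suc (suc k))

  attach : Fin (suc (suc k)) → Fin (suc k)
  attach zero    = zero
  attach (suc i) = i

  consecutive : Fin (suc k) → Fin (suc k) → Bool
  consecutive i j = (toℕ j ≡ᵇ suc (toℕ i)) ∨ (toℕ i ≡ᵇ suc (toℕ j))

  adjV : Vertex → Vertex → Bool
  adjV (inj₁ i) (inj₁ j) = consecutive i j
  adjV (inj₁ i) (inj₂ l) = toℕ i ≡ᵇ toℕ (attach l)
  adjV (inj₂ l) (inj₁ i) = toℕ i ≡ᵇ toℕ (attach l)
  adjV (inj₂ _) (inj₂ _) = false

  adjV-sym : ∀ x y → adjV x y ≡ adjV y x
  adjV-sym (inj₁ i) (inj₁ j) = ∨-comm (toℕ j ≡ᵇ suc (toℕ i)) _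
  adjV-sym (inj₁ i) (inj₂ l) = refl
  adjV-sym (inj₂ l) (inj₁ i) = refl
  adjV-sym (inj₂ _) (inj₂ _) = refl

  adjV-irr : ∀ x → adjV x x ≡ false
  adjV-irr (inj₁ i) = cong₂ _∨_ (≡ᵇ-suc (toℕ i)) (≡ᵇ-suc (toℕ i))
  adjV-irr (inj₂ l) = refl

  leaf-neighbour : ∀ l w → adjV (inj₂ l) w ≡ true → w ≡ inj₁ (attach l)
  leaf-neighbour l (inj₁ i) e = cong inj₁ (toℕ-injective (≡ᵇ-sound e))

  leaf-attached : ∀ l → adjV (inj₂ l) (inj₁ (attach l)) ≡ true
  leaf-attached l = ≡ᵇ-refl (toℕ (attach l))

  spine-next : (i : Fin k) → adjV (inj₁ (inject₁ i)) (inj₁ (suc i)) ≡ true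
  spine-next i rewrite toℕ-inject₁ i | ≡ᵇ-refl (toℕ i) = refl

  spine-prev : (i : Fin k) → adjV (inj₁ (suc i)) (inj₁ (inject₁ i)) ≡ true
  spine-prev i = trans (adjV-sym (inj₁ (suc i)) (inj₁ (inject₁ i))) (spine-next i)

  order : ℕ
  order = suc k + suc (suc k)

  encode : Vertex → Fin order
  encode = join (suc k) (suc (suc k))

  decode : Fin order → Vertex
  decode = splitAt (suc k)

  decode-encode : ∀ x → decode (encode x) ≡ x
  decode-encode = splitAt-join (suc k) (suc (suc k))

  encode-decode : ∀ a → encode (decode a) ≡ a
  encode-decode = join-splitAt (suc k) (suc (suc k))

  encode-injective : ∀ {x y} → encode x ≡ encode y → x ≡ y
  encode-injective {x} {y} e = trans (sym (decode-encode x)) (trans (cong decode e) (decode-encode y))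

  decode-injective : ∀ {a b} → decode a ≡ decode b → a ≡ b
  decode-injective {a} {b} e = trans (sym (encode-decode a)) (trans (cong encode e) (encode-decode b))

  G : Graph
  G = record { n = order ; adj = λ a b → adjV (decode a) (decode b)
             ; adjSym = λ a b → adjV-sym (decode a) (decode b)
             ; adjIrr = λ a → adjV-irr (decode a) }

  adj-encode : ∀ x y → adj G (encode x) (encode y) ≡ adjV x y
  adj-encode x y = cong₂ adjV (decode-encode x) (decode-encode y)

  adj-decode : ∀ x b → adj G (encode x) b ≡ adjV x (decode b)
  adj-decode x b = cong (λ y → adjV y (decode b)) (decode-encode x)

  data SpineNeighbour (x : Fin k) (w : Vertex) : Set where
    next  : w ≡ inj₁ (suc x) → SpineNeighbour x w
    leaf  : ∀ l → w ≡ inj₂ l → attach l ≡ inject₁ x → SpineNeighbour x w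
    below : ∀ z → w ≡ inj₁ z → z <ᶠ inject₁ x → SpineNeighbour x w

  spine-neighbour : ∀ x w → adjV (inj₁ (inject₁ x)) w ≡ true → SpineNeighbour x w
  spine-neighbour x (inj₂ l) e = leaf l refl (sym (toℕ-injective (≡ᵇ-sound e)))
  spine-neighbour x (inj₁ z) e with ∨-true-split e
  ... | inj₁ succ =
    next (cong inj₁ (toℕ-injective (trans (≡ᵇ-sound succ) (cong suc (toℕ-inject₁ x)))))
  ... | inj₂ pred = below z refl (ℕ.≤-reflexive (sym (≡ᵇ-sound pred)))

  module Rigidity (τ : Vertex → Vertex)
                  (τ-adj : ∀ x y → adjV (τ x) (τ y) ≡ adjV x y)
                  (τ-injective : ∀ {x y} → τ x ≡ τ y → x ≡ y)
                  (τ-surjective : ∀ z → ∃[ x ] τ x ≡ z) where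

    adj-image : ∀ {x y a b} → τ x ≡ a → τ y ≡ b → adjV a b ≡ adjV x y
    adj-image refl refl = τ-adj _ _

    onto-fixed : ∀ {x z} → τ x ≡ z → τ z ≡ z → x ≡ z
    onto-fixed τx≡z τz≡z = τ-injective (trans τx≡z (sym τz≡z))

    upper lower : Fin (suc k) → Vertex
    upper z = inj₂ (suc z)
    lower zero    = inj₂ zero
    lower (suc z) = inj₁ (inject₁ z)

    upper-adj : ∀ z → adjV (inj₁ z) (upper z) ≡ true
    upper-adj z = ≡ᵇ-refl (toℕ z)

    lower-adj : ∀ z → adjV (inj₁ z) (lower z) ≡ true
    lower-adj zero    = refl
    lower-adj (suc z) = spine-prev z

    upper≢lower : ∀ z → upper z ≢ lower z
    upper≢lower zero    ()
    upper≢lower (suc z) ()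

    -- A leaf has one neighbour, a spine vertex has two, so no leaf is
    -- mapped onto the spine.
    leaves-stay-leaves : ∀ l z → τ (inj₂ l) ≢ inj₁ z
    leaves-stay-leaves l z τl≡ with τ-surjective (upper z) | τ-surjective (lower z)
    ... | a , τa≡ | b , τb≡ = upper≢lower z
      (trans (sym τa≡) (trans (cong τ (trans (at-attachment a τa≡ (upper-adj z))
                                             (sym (at-attachment b τb≡ (lower-adj z))))) τb≡))
      where
      at-attachment : ∀ x {w} → τ x ≡ w → adjV (inj₁ z) w ≡ true → x ≡ inj₁ (attach l)
      at-attachment x τx≡ zw = leaf-neighbour l x (trans (sym (adj-image τl≡ τx≡)) zw)

    module _ (ℓ₀-fixed : τ (inj₂ zero) ≡ inj₂ zero) where

      -- A leaf whose attachment vertex is fixed is fixed: its image is a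
      -- leaf at the same vertex, and only ℓ₀, ℓ₁ share one.
      leaf-fixed : ∀ l → τ (inj₁ (attach l)) ≡ inj₁ (attach l) → τ (inj₂ l) ≡ inj₂ l
      leaf-fixed l s-fixed with τ (inj₂ l) in τl≡
      ... | inj₁ z  = ⊥-elim (leaves-stay-leaves l z τl≡)
      ... | inj₂ l′ = sibling l l′ same-attachment τl≡
        where
        same-attachment : inj₁ (attach l) ≡ inj₁ (attach l′)
        same-attachment = leaf-neighbour l′ (inj₁ (attach l))
          (trans (adj-image s-fixed τl≡) (leaf-attached l))

        sibling : ∀ l l′ → inj₁ (attach l) ≡ inj₁ (attach l′) →
                  τ (inj₂ l) ≡ inj₂ l′ → inj₂ l′ ≡ inj₂ l
        sibling zero                l′              _    τl≡′ = trans (sym τl≡′) ℓ₀-fixed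
        sibling (suc zero)          zero            _    τl≡′ with onto-fixed τl≡′ ℓ₀-fixed
        ... | ()
        sibling (suc zero)          (suc .zero)     refl _    = refl
        sibling (suc (suc i))       (suc .(suc i))  refl _    = refl

      s₀-fixed : τ (inj₁ zero) ≡ inj₁ zero
      s₀-fixed = leaf-neighbour zero _ (adj-image ℓ₀-fixed refl)

      -- Along the spine, by strong induction: the image of s_{x+1} is a
      -- neighbour of the fixed vertex s_x, and all neighbours of s_x other
      -- than s_{x+1} are already fixed.
      spine-fixed : ∀ i → τ (inj₁ i) ≡ inj₁ i
      spine-fixed = All.wfRec <-wellFounded _ (λ i → τ (inj₁ i) ≡ inj₁ i) spine-step
        where
        spine-step : ∀ x → (∀ {z} → z <ᶠ x → τ (inj₁ z) ≡ inj₁ z) → τ (inj₁ x) ≡ inj₁ x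
        spine-step zero    _       = s₀-fixed
        spine-step (suc x) earlier =
          resolve (spine-neighbour x _ (trans (adj-image y-fixed refl) (spine-next x)))
          where
          y<x : inject₁ x <ᶠ suc x
          y<x = s≤s (ℕ.≤-reflexive (toℕ-inject₁ x))

          y-fixed : τ (inj₁ (inject₁ x)) ≡ inj₁ (inject₁ x)
          y-fixed = earlier y<x

          resolve : SpineNeighbour x (τ (inj₁ (suc x))) → τ (inj₁ (suc x)) ≡ inj₁ (suc x)
          resolve (next τx≡) = τx≡
          resolve (leaf l τx≡ attached)
            with onto-fixed τx≡
                   (leaf-fixed l (subst (λ s → τ (inj₁ s) ≡ inj₁ s) (sym attached) y-fixed))
          ... | ()
          resolve (below z τx≡ z<y) =
            ⊥-elim (<-irrefl (sym (inj₁-injective (onto-fixed τx≡ z-fixed))) z<x)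
            where
            z<x : z <ᶠ suc x
            z<x = ℕ.<-trans z<y y<x
            z-fixed : τ (inj₁ z) ≡ inj₁ z
            z-fixed = earlier z<x

      τ-identity : ∀ x → τ x ≡ x
      τ-identity (inj₁ i) = spine-fixed i
      τ-identity (inj₂ l) = leaf-fixed l (spine-fixed (attach l))

  module Induced (σ : Permutation′ order) (aut : IsAut G σ) where

    τ : Vertex → Vertex
    τ x = decode (σ ⟨$⟩ʳ encode x)

    τ-adj : ∀ x y → adjV (τ x) (τ y) ≡ adjV x y
    τ-adj x y = trans (aut (encode x) (encode y)) (adj-encode x y)

    τ-injective : ∀ {x y} → τ x ≡ τ y → x ≡ y
    τ-injective e = encode-injective (perm-injective σ (decode-injective e))

    τ-surjective : ∀ z → ∃[ x ] τ x ≡ z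
    τ-surjective z = decode (σ ⟨$⟩ˡ encode z) ,
      trans (cong (λ a → decode (σ ⟨$⟩ʳ a)) (encode-decode _))
            (trans (cong decode (inverseʳ σ)) (decode-encode z))

    open Rigidity τ τ-adj τ-injective τ-surjective public

    identity-if-ℓ₀-fixed : τ (inj₂ zero) ≡ inj₂ zero → IsIdentity σ
    identity-if-ℓ₀-fixed ℓ₀-fixed a = decode-injective
      (trans (cong (λ b → decode (σ ⟨$⟩ʳ b)) (sym (encode-decode a)))
             (τ-identity ℓ₀-fixed (decode a)))

  twinLeaf : Fin 2 → Vertex
  twinLeaf zero    = inj₂ zero
  twinLeaf (suc _) = inj₂ (suc zero)

  twinLeaf-like-ℓ₀ : ∀ i w → adjV (twinLeaf i) w ≡ adjV (inj₂ zero) w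
  twinLeaf-like-ℓ₀ zero    w        = refl
  twinLeaf-like-ℓ₀ (suc _) (inj₁ _) = refl
  twinLeaf-like-ℓ₀ (suc _) (inj₂ _) = refl

  twinLeaf-injective : ∀ {i j} → twinLeaf i ≡ twinLeaf j → i ≡ j
  twinLeaf-injective {zero}     {zero}     _ = refl
  twinLeaf-injective {suc zero} {suc zero} _ = refl

  ℓ₀ℓ₁ : PendantTwins G 2
  ℓ₀ℓ₁ = record
    { hub      = encode (inj₁ zero)
    ; leaf     = encode ∘ twinLeaf
    ; distinct = twinLeaf-injective ∘ encode-injective
    ; twins    = λ i j x → trans (adj-like-ℓ₀ i x) (sym (adj-like-ℓ₀ j x))
    ; pendant  = λ i x e → trans (sym (encode-decode x))
                   (cong encode (leaf-neighbour zero (decode x) (trans (sym (adj-like-ℓ₀ i x)) e))) }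
    where
    adj-like-ℓ₀ : ∀ i x → adj G (encode (twinLeaf i)) x ≡ adjV (inj₂ zero) (decode x)
    adj-like-ℓ₀ i x = trans (adj-decode (twinLeaf i) x) (twinLeaf-like-ℓ₀ i (decode x))

  -- Upper bounds: marking ℓ₀, or the edge at ℓ₀, forces an automorphism to
  -- fix ℓ₀ and hence to be the identity.
  isℓ₀ : Vertex → Bool
  isℓ₀ (inj₁ _)       = false
  isℓ₀ (inj₂ zero)    = true
  isℓ₀ (inj₂ (suc _)) = false

  isℓ₀-sound : ∀ x → isℓ₀ x ≡ true → x ≡ inj₂ zero
  isℓ₀-sound (inj₂ zero) _ = refl

  bit : Bool → Fin 2
  bit false = zero
  bit true  = suc zero

  bit-true : ∀ b → bit b ≡ suc zero → b ≡ true
  bit-true true _ = refl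

  vertexLabel : Fin order → Fin 2
  vertexLabel a = bit (isℓ₀ (decode a))

  distNumber : IsDistNumber G 2
  distNumber = (vertexLabel , distinguishing) , pendantTwins⇒distNumber≥ ℓ₀ℓ₁
    where
    distinguishing : DistinguishingVL G 2 vertexLabel
    distinguishing σ aut pres = identity-if-ℓ₀-fixed (isℓ₀-sound _ (bit-true _
        (trans (pres (encode (inj₂ zero))) (cong (bit ∘ isℓ₀) (decode-encode (inj₂ zero))))))
      where open Induced σ aut

  -- An edge is marked iff one of its ends is ℓ₀; the only such edge is s₀ℓ₀.
  edgeLabel : EdgeLabeling G 2
  edgeLabel = record
    { lab    = λ a b → bit (isℓ₀ (decode a) ∨ isℓ₀ (decode b))
    ; labSym = λ a b → cong bit (∨-comm (isℓ₀ (decode a)) (isℓ₀ (decode b))) }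

  distIndex : IsDistIndex G 2
  distIndex = (edgeLabel , distinguishing) , pendantTwins⇒distIndex≥ ℓ₀ℓ₁
    where
    distinguishing : DistinguishingEL G 2 edgeLabel
    distinguishing σ aut pres = identity-if-ℓ₀-fixed (ℓ₀-fixed (∨-true-split (bit-true _ marked)))
      where
      open Induced σ aut
      s₀ ℓ₀ : Fin order
      s₀ = encode (inj₁ zero)
      ℓ₀ = encode (inj₂ zero)

      marked : bit (isℓ₀ (τ (inj₁ zero)) ∨ isℓ₀ (τ (inj₂ zero))) ≡ suc zero
      marked = trans (pres s₀ ℓ₀ (adj-encode (inj₁ zero) (inj₂ zero)))
                     (cong₂ (λ x y → bit (isℓ₀ x ∨ isℓ₀ y))
                            (decode-encode (inj₁ zero)) (decode-encode (inj₂ zero)))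

      -- if s₀ were sent to ℓ₀, then ℓ₀ would be sent to its neighbour s₀
      ℓ₀-fixed : isℓ₀ (τ (inj₁ zero)) ≡ true ⊎ isℓ₀ (τ (inj₂ zero)) ≡ true →
                 τ (inj₂ zero) ≡ inj₂ zero
      ℓ₀-fixed (inj₂ ℓ₀↦ℓ₀) = isℓ₀-sound _ ℓ₀↦ℓ₀
      ℓ₀-fixed (inj₁ s₀↦ℓ₀) = ⊥-elim (leaves-stay-leaves zero zero
        (leaf-neighbour zero _ (adj-image {inj₁ zero} {inj₂ zero} (isℓ₀-sound _ s₀↦ℓ₀) refl)))

  spine-reaches-s₀ : ∀ i → Reach G (encode (inj₁ i)) (encode (inj₁ zero))
  spine-reaches-s₀ = <-weakInduction (λ i → Reach G (encode (inj₁ i)) (encode (inj₁ zero)))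
    here (λ i → step (trans (adj-encode (inj₁ (suc i)) (inj₁ (inject₁ i))) (spine-prev i)))

  connected : Connected G
  connected = connected-via-root G (encode (inj₁ zero)) reaches
    where
    reaches-from : ∀ x → Reach G (encode x) (encode (inj₁ zero))
    reaches-from (inj₁ i) = spine-reaches-s₀ i
    reaches-from (inj₂ l) = step (trans (adj-encode (inj₂ l) (inj₁ (attach l))) (leaf-attached l))
                                 (spine-reaches-s₀ (attach l))

    reaches : ∀ a → Reach G a (encode (inj₁ zero))
    reaches a = subst (λ b → Reach G b (encode (inj₁ zero))) (encode-decode a) (reaches-from (decode a))

  longPath : Fin (suc (suc k)) → Vertex
  longPath zero    = inj₂ zero
  longPath (suc i) = inj₁ i

  longPath-injective : ∀ {a b} → longPath a ≡ longPath b → a ≡ b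
  longPath-injective {zero}  {zero}  _ = refl
  longPath-injective {suc a} {suc b} e = cong suc (inj₁-injective e)

  pendantEdge : Fin (suc k) → Fin 2 → Vertex
  pendantEdge i zero    = inj₁ i
  pendantEdge i (suc _) = inj₂ (suc i)

  pendantEdge-injective : ∀ {i j a b} → pendantEdge i a ≡ pendantEdge j b → i ≡ j × a ≡ b
  pendantEdge-injective {a = zero}     {zero}     refl = refl , refl
  pendantEdge-injective {a = suc zero} {suc zero} refl = refl , refl

  P₀ : GPath G
  P₀ = record
    { len = suc k ; len≥1 = s≤s z≤n ; vtx = encode ∘ longPath
    ; adjacent = steps ; shape = inj₁ (longPath-injective ∘ encode-injective) }
    where
    steps : ∀ (i : Fin (suc k)) →
            adj G (encode (longPath (inject₁ i))) (encode (longPath (suc i))) ≡ true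
    steps zero    = adj-encode (inj₂ zero) (inj₁ zero)
    steps (suc i) = trans (adj-encode (inj₁ (inject₁ i)) (inj₁ (suc i))) (spine-next i)

  Q : Fin (suc k) → GPath G
  Q i = record
    { len = 1 ; len≥1 = s≤s z≤n ; vtx = encode ∘ pendantEdge i
    ; adjacent = λ { zero → trans (adj-encode (inj₁ i) (inj₂ (suc i))) (≡ᵇ-refl (toℕ i)) }
    ; shape = inj₁ (λ e → proj₂ (pendantEdge-injective (encode-injective e))) }

  paths : Fin (suc (suc k)) → GPath G
  paths zero    = P₀
  paths (suc i) = Q i

  -- Only P₀ has internal vertices: a one-edge path has none.
  internal-only-in-P₀ : ∀ i v → Internal (paths i) v → i ≡ zero
  internal-only-in-P₀ zero    v _ = refl
  internal-only-in-P₀ (suc i) v ((zero , e) , not-first , _) = ⊥-elim (not-first (sym e))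
  internal-only-in-P₀ (suc i) v ((suc zero , e) , _ , not-last) = ⊥-elim (not-last (sym e))

  UniquelyCovered : Fin order → Fin order → Set
  UniquelyCovered u v = ∃[ i ] (EdgeOn (paths i) u v × (∀ j → EdgeOn (paths j) u v → j ≡ i))

  EdgeOn-sym : ∀ {P : GPath G} {u v} → EdgeOn P u v → EdgeOn P v u
  EdgeOn-sym (e , inj₁ ends) = e , inj₂ ends
  EdgeOn-sym (e , inj₂ ends) = e , inj₁ ends

  uniquelyCovered-sym : ∀ {u v} → UniquelyCovered u v → UniquelyCovered v u
  uniquelyCovered-sym (i , on , unique) =
    i , EdgeOn-sym {paths i} on , λ j on′ → unique j (EdgeOn-sym {paths j} on′)

  Q-edge : ∀ t x y → EdgeOn (Q t) (encode x) (encode y) →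
           (x ≡ inj₁ t × y ≡ inj₂ (suc t)) ⊎ (x ≡ inj₂ (suc t) × y ≡ inj₁ t)
  Q-edge t x y (zero , inj₁ (ex , ey)) = inj₁ (sym (encode-injective ex) , sym (encode-injective ey))
  Q-edge t x y (zero , inj₂ (ey , ex)) = inj₂ (sym (encode-injective ex) , sym (encode-injective ey))

  longPath-misses-ℓ : ∀ t a → longPath a ≢ inj₂ (suc t)
  longPath-misses-ℓ t zero    ()
  longPath-misses-ℓ t (suc a) ()

  P₀-misses-ℓ : ∀ t y → ¬ EdgeOn P₀ (encode y) (encode (inj₂ (suc t)))
  P₀-misses-ℓ t y (e , inj₁ (_ , on)) = longPath-misses-ℓ t (suc e) (encode-injective on)
  P₀-misses-ℓ t y (e , inj₂ (on , _)) = longPath-misses-ℓ t (inject₁ e) (encode-injective on)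

  spine-edge-covered : ∀ i j → toℕ j ≡ suc (toℕ i) →
                       UniquelyCovered (encode (inj₁ i)) (encode (inj₁ j))
  spine-edge-covered i (suc j) j≡i+1 =
    zero , (suc j , inj₁ (cong (encode ∘ inj₁) j≡i , refl)) , only-P₀
    where
    j≡i : inject₁ j ≡ i
    j≡i = toℕ-injective (trans (toℕ-inject₁ j) (ℕ.suc-injective j≡i+1))

    only-P₀ : ∀ p → EdgeOn (paths p) (encode (inj₁ i)) (encode (inj₁ (suc j))) → p ≡ zero
    only-P₀ zero    _  = refl
    only-P₀ (suc t) on with Q-edge t (inj₁ i) (inj₁ (suc j)) on
    ... | inj₁ (_ , ())
    ... | inj₂ (() , _)

  leaf-edge-covered : ∀ i l → toℕ i ≡ toℕ (attach l) →
                      UniquelyCovered (encode (inj₁ i)) (encode (inj₂ l))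
  leaf-edge-covered i zero i≡0 with toℕ-injective {i = i} {j = zero} i≡0
  ... | refl = zero , (zero , inj₂ (refl , refl)) , only-P₀
    where
    only-P₀ : ∀ p → EdgeOn (paths p) (encode (inj₁ zero)) (encode (inj₂ zero)) → p ≡ zero
    only-P₀ zero    _  = refl
    only-P₀ (suc t) on with Q-edge t (inj₁ zero) (inj₂ zero) on
    ... | inj₁ (_ , ())
    ... | inj₂ (() , _)
  leaf-edge-covered i (suc t) i≡t with toℕ-injective {i = i} {j = t} i≡t
  ... | refl = suc i , (zero , inj₁ (refl , refl)) , only-Qᵢ
    where
    only-Qᵢ : ∀ p → EdgeOn (paths p) (encode (inj₁ i)) (encode (inj₂ (suc i))) → p ≡ suc i
    only-Qᵢ zero     on = ⊥-elim (P₀-misses-ℓ i (inj₁ i) on)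
    only-Qᵢ (suc t′) on with Q-edge t′ (inj₁ i) (inj₂ (suc i)) on
    ... | inj₁ (refl , _) = refl
    ... | inj₂ (() , _)

  covered : ∀ x y → adjV x y ≡ true → UniquelyCovered (encode x) (encode y)
  covered (inj₁ i) (inj₁ j) e with ∨-true-split e
  ... | inj₁ succ = spine-edge-covered i j (≡ᵇ-sound succ)
  ... | inj₂ pred = uniquelyCovered-sym (spine-edge-covered j i (≡ᵇ-sound pred))
  covered (inj₁ i) (inj₂ l) e = leaf-edge-covered i l (≡ᵇ-sound e)
  covered (inj₂ l) (inj₁ i) e = uniquelyCovered-sym (leaf-edge-covered i l (≡ᵇ-sound e))

  ψ : GraphoidalCover G
  ψ = record
    { m        = suc (suc k)
    ; path     = paths
    ; intUniq  = λ v i j int-i int-j →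
                   trans (internal-only-in-P₀ i v int-i) (sym (internal-only-in-P₀ j v int-j))
    ; edgeUniq = λ u v e → subst₂ UniquelyCovered (encode-decode u) (encode-decode v)
                             (covered (decode u) (decode v) e) }

  -- Ω(G, ψ) is the star with centre P₀: P₀ meets every Q_i in s_i, while
  -- distinct Q_i, Q_j are disjoint.
  Ω-star : ∀ a b → adj (Ω G ψ) a b ≡ starAdj a b
  Ω-star zero    zero    = adjIrr (Ω G ψ) zero
  Ω-star zero    (suc i) = isYes-true (¬? (zero ≟ suc i) ×-dec shares? P₀ (Q i))
                                      ((λ ()) , suc i , zero , refl)
  Ω-star (suc i) zero    = isYes-true (¬? (suc i ≟ zero) ×-dec shares? (Q i) P₀)
                                      ((λ ()) , zero , suc i , refl)
  Ω-star (suc i) (suc j) = isYes-false (¬? (suc i ≟ suc j) ×-dec shares? (Q i) (Q j))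
    (λ { (i≢j , a , b , e) →
           i≢j (cong suc (proj₁ (pendantEdge-injective {i} {j} {a} {b} (encode-injective e)))) })

mainTheorem3 : ∀ (N : ℕ) → 0 < N →
    ∃[ G ] ∃[ ψ ] Connected G ×
      ∃[ r₁ ] ∃[ r₂ ] ∃[ d₁ ] ∃[ d₂ ]
        (IsDistNumber G r₁ × IsDistNumber (Ω G ψ) r₂ ×
         IsDistIndex G d₁ × IsDistIndex (Ω G ψ) d₂ ×
         N ≤ ∣ r₁ - r₂ ∣ × N ≤ ∣ d₁ - d₂ ∣)
mainTheorem3 N _ =
  G , ψ , connected , 2 , 2 + N , 2 , 2 + N ,
  distNumber , ΩStar.distNumber , distIndex , ΩStar.distIndex ,
  ℕ.≤-refl , ℕ.≤-refl
  where
  open Caterpillar (suc N)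
  module ΩStar = Star N (adj (Ω G ψ)) (adjSym (Ω G ψ)) (adjIrr (Ω G ψ)) Ω-star
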